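{- For any positive integers $m,n$ with $m\leq n$ there is a theory $T_{mn}$ with ${\rm aar}(T_{mn})=m$ and ${\rm ar}(T_{mn})=n$.
   Context: For $n\geq 1$, a formula $\varphi(\overline{x})$ of a first-order theory $T$ is called $n$-ary (an $n$-formula) if it is $T$-equivalent to a Boolean combination of $T$-formulas each of which has $n$ free variables. $T$ is unary ($1$-ary) if every $T$-formula is $T$-equivalent to a Boolean combination of $T$-formulas with one free variable and formulas of the form $x\approx y$; for $n\geq 2$, $T$ is $n$-ary if every $T$-formula is $n$-ary. ${\rm ar}(T)=n$ if $T$ is $n$-ary and not $(n-1)$-ary; ${\rm ar}(T)=\infty$ if $T$ is not $n$-ary for any $n$. $T$ is almost $n$-ary if there are finitely many formulas $\varphi_1(\overline{x}),\ldots,\varphi_m(\overline{x})$ such that every $T$-formula is $T$-equivalent to a Boolean combination of $n$-formulas and of formulas obtained from $\varphi_1(\overline{x}),\ldots,\varphi_m(\overline{x})$ by substitutions of free variables. ${\rm aar}(T)$ is the least $n$ such that $T$ is almost $n$-ary, and ${\rm aar}(T)=\infty$ if there is no such $n$. -}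

module Defs where

open import Level using (Level; Lift; lift) renaming (zero to lzero; suc to lsuc)
open import Data.Nat using (ℕ; zero; suc; _≤_; _<_)
open import Data.Vec using (Vec; []; _∷_)
open import Data.List using (List)
open import Data.Product using (Σ; _×_; _,_)
open import Data.Sum using (_⊎_)
open import Data.Empty using (⊥)
open import Relation.Nullary using (¬_)
open import Relation.Binary.PropositionalEquality using (_≡_)
import Data.Vec.Membership.Propositional as VecMem
import Data.List.Membership.Propositional as ListMem

record Language : Set₁ where
  field
    Rel    : Set
    rarity : Rel → ℕ
    Fun    : Set
    farity : Fun → ℕ

open Language public

-- Syntax. Variables are de Bruijn indices (the free variable x_i is `var i`
-- at top level).
module _ (L : Language) where

  data Term : Set where
    var : ℕ → Term
    app : (f : Fun L) → Vec Term (farity L f) → Term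

  infixr 5 _⇒_
  infix 7 _≈'_
  data Formula : Set where
    ⊥'   : Formula
    rel  : (r : Rel L) → Vec Term (rarity L r) → Formula
    _≈'_ : Term → Term → Formula
    _⇒_  : Formula → Formula → Formula
    ∀'   : Formula → Formula

  -- A theory is a set of formulas (understood as their universal closures).
  Theory : Set₁
  Theory = Formula → Set

  record Structure : Set₁ where
    field
      Carrier     : Set
      inhabitant  : Carrier
      relI        : (r : Rel L) → Vec Carrier (rarity L r) → Set
      funI        : (f : Fun L) → Vec Carrier (farity L f) → Carrier

module _ {L : Language} where

  ext : (ℕ → ℕ) → ℕ → ℕ
  ext ρ zero    = zero
  ext ρ (suc x) = suc (ρ x)

  mutual
    renT : (ℕ → ℕ) → Term L → Term L
    renT ρ (var x)    = var (ρ x)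
    renT ρ (app f ts) = app f (renTs ρ ts)

    renTs : ∀ {k} → (ℕ → ℕ) → Vec (Term L) k → Vec (Term L) k
    renTs ρ []       = []
    renTs ρ (t ∷ ts) = renT ρ t ∷ renTs ρ ts

  renF : (ℕ → ℕ) → Formula L → Formula L
  renF ρ ⊥'         = ⊥'
  renF ρ (rel r ts) = rel r (renTs ρ ts)
  renF ρ (s ≈' t)   = renT ρ s ≈' renT ρ t
  renF ρ (φ ⇒ ψ)    = renF ρ φ ⇒ renF ρ ψ
  renF ρ (∀' φ)     = ∀' (renF (ext ρ) φ)

  mutual
    freeT : ℕ → Term L → Set
    freeT x (var y)    = x ≡ y
    freeT x (app f ts) = freeTs x ts

    freeTs : ∀ {k} → ℕ → Vec (Term L) k → Set
    freeTs x []       = ⊥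
    freeTs x (t ∷ ts) = freeT x t ⊎ freeTs x ts

  freeF : ℕ → Formula L → Set
  freeF x ⊥'         = ⊥
  freeF x (rel r ts) = freeTs x ts
  freeF x (s ≈' t)   = freeT x s ⊎ freeT x t
  freeF x (φ ⇒ ψ)    = freeF x φ ⊎ freeF x ψ
  freeF x (∀' φ)     = freeF (suc x) φ

  HasFreeVars : ℕ → Formula L → Set
  HasFreeVars n φ = Σ (Vec ℕ n) λ xs → ∀ x → freeF x φ → x VecMem.∈ xs

  IsVarEq : Formula L → Set
  IsVarEq φ = Σ ℕ λ i → Σ ℕ λ j → φ ≡ (var i ≈' var j)

  -- Semantics (atoms are double-negated so that satisfaction is stable;
  -- classically this is ordinary Tarski semantics)
  module _ (M : Structure L) where
    open Structure M

    _∷ₑ_ : Carrier → (ℕ → Carrier) → ℕ → Carrier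
    (a ∷ₑ env) zero    = a
    (a ∷ₑ env) (suc x) = env x

    mutual
      evalT : (ℕ → Carrier) → Term L → Carrier
      evalT env (var x)    = env x
      evalT env (app f ts) = funI f (evalTs env ts)

      evalTs : ∀ {k} → (ℕ → Carrier) → Vec (Term L) k → Vec Carrier k
      evalTs env []       = []
      evalTs env (t ∷ ts) = evalT env t ∷ evalTs env ts

    Sat : (ℕ → Carrier) → Formula L → Set
    Sat env ⊥'         = ⊥
    Sat env (rel r ts) = ¬ ¬ relI r (evalTs env ts)
    Sat env (s ≈' t)   = ¬ ¬ (evalT env s ≡ evalT env t)
    Sat env (φ ⇒ ψ)    = Sat env φ → Sat env ψ
    Sat env (∀' φ)     = (a : Carrier) → Sat (a ∷ₑ env) φ

  IsModel : Structure L → Theory L → Set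
  IsModel M T = ∀ φ → T φ → ∀ env → Sat M env φ

  HasModel : Theory L → Set₁
  HasModel T = Σ (Structure L) λ M → IsModel M T

  TEquiv : Theory L → Formula L → Formula L → Set₁
  TEquiv T φ ψ = ∀ (M : Structure L) → IsModel M T → ∀ env →
                 (Sat M env φ → Sat M env ψ) × (Sat M env ψ → Sat M env φ)

  -- Boolean combinations of formulas from S (⊥ and → form a complete basis)
  data BoolComb {ℓ : Level} (S : Formula L → Set ℓ) : Formula L → Set ℓ where
    base : ∀ {φ} → S φ → BoolComb S φ
    bot  : BoolComb S ⊥'
    imp  : ∀ {φ ψ} → BoolComb S φ → BoolComb S ψ → BoolComb S (φ ⇒ ψ)

  EquivBC : ∀ {ℓ} → Theory L → (Formula L → Set ℓ) → Formula L → Set (lsuc lzero Level.⊔ ℓ)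
  EquivBC T S φ = Σ (Formula L) λ ψ → BoolComb S ψ × TEquiv T φ ψ

  NFormula : ℕ → Theory L → Formula L → Set₁
  NFormula n T φ = EquivBC T (HasFreeVars n) φ

  Unary : Theory L → Set₁
  Unary T = ∀ φ → EquivBC T (λ χ → HasFreeVars 1 χ ⊎ IsVarEq χ) φ

  IsNary : ℕ → Theory L → Set₁
  IsNary (suc zero) T = Unary T
  IsNary n          T = ∀ φ → NFormula n T φ

  ArIs : Theory L → ℕ → Set₁
  ArIs T zero          = Lift _ ⊥
  ArIs T (suc zero)    = IsNary 1 T
  ArIs T (suc (suc k)) = IsNary (suc (suc k)) T × ¬ IsNary (suc k) T

  AlmostNary : ℕ → Theory L → Set₁
  AlmostNary n T =
    Σ (List (Formula L)) λ φs → ∀ φ →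
      EquivBC T (λ χ → NFormula n T χ
                     ⊎ Σ (ℕ → ℕ) λ ρ → Σ (Formula L) λ θ → θ ListMem.∈ φs × χ ≡ renF ρ θ) φ

  AarIs : Theory L → ℕ → Set₁
  AarIs T m = 1 ≤ m × AlmostNary m T × (∀ k → 1 ≤ k → k < m → ¬ AlmostNary k T)

-- T is the complete theory of a generic structure M for a language with relation symbols R_i
-- (i ∈ ℕ) of arity m and S of arity n: an element of M is built from the facts it witnesses.
-- A finite partial isomorphism between assignments extends by one more element -- a fresh
-- element witnessing exactly the required facts -- so every formula is equivalent in M to a
-- Boolean combination of sentences and atoms.  The atoms are equalities, m-ary R_i-atoms and
-- renamings of S(x₀, …, x_{n-1}), whence aar(T) ≤ m and ar(T) ≤ n.  Conversely, for each q
-- there are two assignments that agree on every formula with at most q free variables and on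
-- every formula avoiding a given symbol r, but differ on r(x₀, …, x_q).  Taking for r an R_N
-- with N fresh for the finitely many extra formulas gives aar(T) ≥ m; taking S gives ar(T) ≥ n.

module Submission where

open import Defs
open import Function using (_∘_; id)
open import Data.Nat using (ℕ; zero; suc; pred; _+_; _⊔_; _⊓_; _≤_; _<_; z≤n; s≤s)
open import Data.Nat.Properties
  using ( _≟_; ≤-refl; ≤-trans; <-irrefl; ≤-<-trans; <-≤-trans; ≤-pred; n<1+n; <⇒≤pred; m<n⇒m<1+n
        ; m<1+n⇒m<n∨m≡n; +-suc; +-identityʳ; m≤m⊔n; m≤n⊔m; m≤n+m; m≤n⇒m⊓n≡m)
open import Data.Fin using (Fin; toℕ)
open import Data.Fin.Properties using (pigeonhole; toℕ<n)
open import Data.Product using (Σ; _×_; _,_; proj₁; proj₂)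
open import Data.Sum using (_⊎_; inj₁; inj₂; [_,_])
open import Data.Empty using (⊥; ⊥-elim)
open import Data.Unit using (⊤; tt)
open import Data.Maybe using (Maybe; just; nothing)
open import Data.Maybe.Properties using (just-injective)
open import Data.Vec as Vec using (Vec; []; _∷_; toList)
open import Data.Vec.Properties using (toList-map; length-toList)
open import Data.Vec.Membership.Propositional.Properties using (∈-toList⁺; ∈-toList⁻)
open import Data.Vec.Membership.Propositional using () renaming (_∈_ to _V∈_)
open import Data.Vec.Relation.Unary.Any using (here; there)
open import Data.List using (List; []; _∷_; _++_; map; concatMap; filter; applyUpTo; upTo; length; lookup)
open import Data.List.Extrema.Nat using (max; v≤max⁺)
open import Data.List.Properties using (map-cong-local; map-∘; map-applyUpTo; ∷-injectiveˡ; ∷-injectiveʳ)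
open import Data.List.Relation.Unary.Any as Any using (Any; here; there; any?)
open import Data.List.Relation.Unary.Any.Properties using (lookup-index)
open import Data.List.Relation.Unary.All as All using (All; []; _∷_)
import Data.List.Relation.Unary.All.Properties as All
open import Data.List.Membership.Propositional using (_∈_; _∉_; find; lose)
open import Data.List.Membership.Propositional.Properties
  using ( ∈-map⁺; ∈-map⁻; ∈-concatMap⁺; ∈-concatMap⁻; ∈-filter⁺; ∈-filter⁻; ∈-++⁺ˡ; ∈-++⁺ʳ; ∈-++⁻
        ; ∈-upTo⁺; ∈-upTo⁻; ∈-applyUpTo⁺)
open import Relation.Nullary using (¬_; Dec; yes; no)
open import Relation.Nullary.Decidable using (decidable-stable)
open import Relation.Binary.PropositionalEquality
  using (_≡_; _≢_; refl; sym; trans; cong; cong₂; subst; module ≡-Reasoning)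
open ≡-Reasoning

data Symbol : Set where
  R : ℕ → Symbol
  S : Symbol

-- An element is a tag together with the list of facts it witnesses.  Inside a
-- fact witnessed by c the positions of c itself are marked by nothing, so an
-- element can witness facts about itself without containing itself.
mutual
  data Elem : Set where
    elem : ℕ → List Fact → Elem

  data Fact : Set where
    fact : Symbol → List (Maybe Elem) → Fact

tag : Elem → ℕ
tag (elem t _) = t

claims : Elem → List Fact
claims (elem _ fs) = fs

entries : Fact → List (Maybe Elem)
entries (fact _ xs) = xs

fact-injective : ∀ {r r′ xs ys} → fact r xs ≡ fact r′ ys → r ≡ r′ × xs ≡ ys
fact-injective refl = refl , refl

_≟ˢ_ : (r r′ : Symbol) → Dec (r ≡ r′)
R i ≟ˢ R j with i ≟ j
... | yes refl = yes refl
... | no i≢j   = no λ { refl → i≢j refl }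
R _ ≟ˢ S   = no λ ()
S   ≟ˢ R _ = no λ ()
S   ≟ˢ S   = yes refl

mutual
  _≟ᵉ_ : (x y : Elem) → Dec (x ≡ y)
  elem t fs ≟ᵉ elem t′ fs′ with t ≟ t′ | ≟-facts fs fs′
  ... | yes refl | yes refl = yes refl
  ... | no t≢t′  | _        = no λ { refl → t≢t′ refl }
  ... | yes _    | no fs≢   = no λ { refl → fs≢ refl }

  ≟-facts : (fs gs : List Fact) → Dec (fs ≡ gs)
  ≟-facts []       []       = yes refl
  ≟-facts []       (_ ∷ _)  = no λ ()
  ≟-facts (_ ∷ _)  []       = no λ ()
  ≟-facts (f ∷ fs) (g ∷ gs) with ≟-fact f g | ≟-facts fs gs
  ... | yes refl | yes refl = yes refl
  ... | no f≢g   | _        = no λ { refl → f≢g refl }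
  ... | yes _    | no fs≢   = no λ { refl → fs≢ refl }

  ≟-fact : (f g : Fact) → Dec (f ≡ g)
  ≟-fact (fact r xs) (fact r′ ys) with r ≟ˢ r′ | ≟-entries xs ys
  ... | yes refl | yes refl = yes refl
  ... | no r≢r′  | _        = no λ { refl → r≢r′ refl }
  ... | yes _    | no xs≢   = no λ { refl → xs≢ refl }

  ≟-entries : (xs ys : List (Maybe Elem)) → Dec (xs ≡ ys)
  ≟-entries []       []       = yes refl
  ≟-entries []       (_ ∷ _)  = no λ ()
  ≟-entries (_ ∷ _)  []       = no λ ()
  ≟-entries (x ∷ xs) (y ∷ ys) with ≟-entry x y | ≟-entries xs ys
  ... | yes refl | yes refl = yes refl
  ... | no x≢y   | _        = no λ { refl → x≢y refl }
  ... | yes _    | no xs≢   = no λ { refl → xs≢ refl }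

  ≟-entry : (x y : Maybe Elem) → Dec (x ≡ y)
  ≟-entry nothing  nothing  = yes refl
  ≟-entry nothing  (just _) = no λ ()
  ≟-entry (just _) nothing  = no λ ()
  ≟-entry (just x) (just y) with x ≟ᵉ y
  ... | yes refl = yes refl
  ... | no x≢y   = no λ { refl → x≢y refl }

open import Data.List.Membership.DecPropositional ≟-fact using () renaming (_∈?_ to _∈ᶠ?_)
open import Data.List.Membership.DecPropositional _≟_ using () renaming (_∈?_ to _∈ℕ?_)

mask : Elem → Elem → Maybe Elem
mask c x with x ≟ᵉ c
... | yes _ = nothing
... | no _  = just x

mask-self : ∀ c → mask c c ≡ nothing
mask-self c with c ≟ᵉ c
... | yes _   = refl
... | no c≢c = ⊥-elim (c≢c refl)

mask-other : ∀ c x → x ≢ c → mask c x ≡ just x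
mask-other c x x≢c with x ≟ᵉ c
... | yes x≡c = ⊥-elim (x≢c x≡c)
... | no _    = refl

mask-just : ∀ c x y → mask c x ≡ just y → x ≡ y
mask-just c x y eq with x ≟ᵉ c
mask-just c x y ()   | yes _
mask-just c x y refl | no _ = refl

Holds : Symbol → List Elem → Set
Holds r cs = Any (λ c → fact r (map (mask c) cs) ∈ claims c) cs

holds? : ∀ r cs → Dec (Holds r cs)
holds? r cs = any? (λ c → fact r (map (mask c) cs) ∈ᶠ? claims c) cs

mutual
  maxTag : Elem → ℕ
  maxTag (elem t fs) = t ⊔ maxTag-facts fs

  maxTag-facts : List Fact → ℕ
  maxTag-facts []       = 0
  maxTag-facts (fact _ xs ∷ fs) = maxTag-entries xs ⊔ maxTag-facts fs

  maxTag-entries : List (Maybe Elem) → ℕ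
  maxTag-entries []             = 0
  maxTag-entries (nothing ∷ xs) = maxTag-entries xs
  maxTag-entries (just x ∷ xs)  = maxTag x ⊔ maxTag-entries xs

OccursIn : Elem → Elem → Set
OccursIn x y = Any (λ f → just x ∈ entries f) (claims y)

occursIn⇒maxTag≤ : ∀ x y → OccursIn x y → maxTag x ≤ maxTag y
occursIn⇒maxTag≤ x (elem t fs) p = ≤-trans (facts fs p) (m≤n⊔m t _)
  where
  entries≤ : ∀ xs → just x ∈ xs → maxTag x ≤ maxTag-entries xs
  entries≤ (just _ ∷ xs)  (here refl) = m≤m⊔n _ (maxTag-entries xs)
  entries≤ (nothing ∷ xs) (there q)   = entries≤ xs q
  entries≤ (just y ∷ xs)  (there q)   = ≤-trans (entries≤ xs q) (m≤n⊔m _ _)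

  facts : ∀ fs → Any (λ f → just x ∈ entries f) fs → maxTag x ≤ maxTag-facts fs
  facts (fact _ xs ∷ fs) (here q) = ≤-trans (entries≤ xs q) (m≤m⊔n _ _)
  facts (fact _ xs ∷ fs) (there q) = ≤-trans (facts fs q) (m≤n⊔m (maxTag-entries xs) _)

applyUpTo-cong-< : ∀ {A : Set} {f g : ℕ → A} k → (∀ i → i < k → f i ≡ g i) → applyUpTo f k ≡ applyUpTo g k
applyUpTo-cong-< zero    f≡g = refl
applyUpTo-cong-< (suc k) f≡g =
  cong₂ _∷_ (f≡g 0 (s≤s z≤n)) (applyUpTo-cong-< k (λ i i<k → f≡g (suc i) (s≤s i<k)))

Iff : Set → Set → Set
Iff A B = (A → B) × (B → A)

Iff-sym : ∀ {A B} → Iff A B → Iff B A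
Iff-sym (f , g) = g , f

module Construction (m n : ℕ) where

  arity : Symbol → ℕ
  arity (R _) = m
  arity S     = n

  L : Language
  L = record { Rel = Symbol ; rarity = arity ; Fun = ⊥ ; farity = λ () }

  M : Structure L
  M = record
    { Carrier = Elem ; inhabitant = elem 0 [] ; relI = λ r xs → Holds r (toList xs) ; funI = λ () }

  T : Theory L
  T φ = ∀ env → Sat M env φ

  M⊨T : IsModel M T
  M⊨T φ M⊨φ = M⊨φ

  Fm : Set
  Fm = Formula L

  Tm : Set
  Tm = Term L

  Env : Set
  Env = ℕ → Elem

  infix 4 _⊨_
  _⊨_ : Env → Fm → Set
  e ⊨ φ = Sat M e φ

  infixr 5 _∷′_
  _∷′_ : Elem → Env → Env
  _∷′_ = _∷ₑ_ M

  ⊨-stable : ∀ e φ → ¬ ¬ (e ⊨ φ) → e ⊨ φ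
  ⊨-stable e ⊥'         ¬¬s = ¬¬s id
  ⊨-stable e (rel r ts) ¬¬s = λ k → ¬¬s (λ s → s k)
  ⊨-stable e (s ≈' t)   ¬¬s = λ k → ¬¬s (λ s → s k)
  ⊨-stable e (φ ⇒ ψ)    ¬¬s = λ sφ → ⊨-stable e ψ (λ k → ¬¬s (λ s → k (s sφ)))
  ⊨-stable e (∀' φ)     ¬¬s = λ a → ⊨-stable (a ∷′ e) φ (λ k → ¬¬s (λ s → k (s a)))

  ⊨-byCases : ∀ e φ (P : Set) → (P → e ⊨ φ) → (¬ P → e ⊨ φ) → e ⊨ φ
  ⊨-byCases e φ P f g = ⊨-stable e φ (λ k → k (g (λ p → k (f p))))

  varOf : Tm → ℕ
  varOf (var x)    = x
  varOf (app () _)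

  varsOf : ∀ {k} → Vec Tm k → Vec ℕ k
  varsOf = Vec.map varOf

  evalTs-varsOf : ∀ e {k} (ts : Vec Tm k) → toList (evalTs M e ts) ≡ map e (toList (varsOf ts))
  evalTs-varsOf e []              = refl
  evalTs-varsOf e (var x ∷ ts)    = cong (e x ∷_) (evalTs-varsOf e ts)
  evalTs-varsOf e (app () _ ∷ _)

  evalTs-var : ∀ e {k} (xs : Vec ℕ k) → toList (evalTs M e (Vec.map var xs)) ≡ map e (toList xs)
  evalTs-var e []       = refl
  evalTs-var e (x ∷ xs) = cong (e x ∷_) (evalTs-var e xs)

  ∈varsOf⇒freeTs : ∀ {x k} (ts : Vec Tm k) → x ∈ toList (varsOf ts) → freeTs x ts
  ∈varsOf⇒freeTs (var _ ∷ ts)   (here refl) = inj₁ refl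
  ∈varsOf⇒freeTs (var _ ∷ ts)   (there p)   = inj₂ (∈varsOf⇒freeTs ts p)
  ∈varsOf⇒freeTs (app () _ ∷ _) _

  freeTs-var⇒∈ : ∀ {x k} (xs : Vec ℕ k) → freeTs {L = L} x (Vec.map var xs) → x ∈ toList xs
  freeTs-var⇒∈ (_ ∷ xs) (inj₁ refl) = here refl
  freeTs-var⇒∈ (_ ∷ xs) (inj₂ p)    = there (freeTs-var⇒∈ xs p)

  evalTs-coincide : ∀ (e e′ : Env) {k} (ts : Vec Tm k) →
    (∀ x → freeTs x ts → e x ≡ e′ x) → evalTs M e ts ≡ evalTs M e′ ts
  evalTs-coincide e e′ []              same = refl
  evalTs-coincide e e′ (var x ∷ ts)    same =
    cong₂ _∷_ (same x (inj₁ refl)) (evalTs-coincide e e′ ts (λ y p → same y (inj₂ p)))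
  evalTs-coincide e e′ (app () _ ∷ _) same

  ⊨-coincide : ∀ φ (e e′ : Env) → (∀ x → freeF x φ → e x ≡ e′ x) → e ⊨ φ → e′ ⊨ φ
  ⊨-coincide ⊥'                e e′ same s = s
  ⊨-coincide (rel r ts)        e e′ same s =
    subst (λ v → ¬ ¬ Holds r (toList v)) (evalTs-coincide e e′ ts same) s
  ⊨-coincide (var i ≈' var j)  e e′ same s rewrite same i (inj₁ refl) | same j (inj₂ refl) = s
  ⊨-coincide (app () _ ≈' _)   e e′ same s
  ⊨-coincide (var _ ≈' app () _) e e′ same s
  ⊨-coincide (φ ⇒ ψ)           e e′ same s = λ sφ →
    ⊨-coincide ψ e e′ (λ x p → same x (inj₂ p))
      (s (⊨-coincide φ e′ e (λ x p → sym (same x (inj₁ p))) sφ))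
  ⊨-coincide (∀' φ)            e e′ same s = λ a → ⊨-coincide φ (a ∷′ e) (a ∷′ e′) (same′ a) (s a)
    where
    same′ : ∀ a x → freeF x φ → (a ∷′ e) x ≡ (a ∷′ e′) x
    same′ a zero    _ = refl
    same′ a (suc x) p = same x p

  M-equiv⇒TEquiv : ∀ φ ψ → (∀ e → e ⊨ φ → e ⊨ ψ) → (∀ e → e ⊨ ψ → e ⊨ φ) → TEquiv T φ ψ
  M-equiv⇒TEquiv φ ψ f g N N⊨T env = N⊨T (φ ⇒ ψ) f env , N⊨T (ψ ⇒ φ) g env

  TEquiv⇒M-equiv : ∀ {φ ψ} → TEquiv T φ ψ → ∀ e → Iff (e ⊨ φ) (e ⊨ ψ)
  TEquiv⇒M-equiv φ≡ψ = φ≡ψ M M⊨T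

  BoolComb-agree : ∀ {ℓ} {B : Fm → Set ℓ} (e e′ : Env) → (∀ χ → B χ → Iff (e ⊨ χ) (e′ ⊨ χ)) →
    ∀ {ψ} → BoolComb B ψ → Iff (e ⊨ ψ) (e′ ⊨ ψ)
  BoolComb-agree e e′ same (base b) = same _ b
  BoolComb-agree e e′ same bot      = id , id
  BoolComb-agree e e′ same (imp p q) with BoolComb-agree e e′ same p | BoolComb-agree e e′ same q
  ... | f₁ , g₁ | f₂ , g₂ = (λ s a → f₂ (s (g₁ a))) , (λ s a → g₂ (s (f₁ a)))

  AllIn : List ℕ → List ℕ → Set
  AllIn xs V = All (_∈ V) xs

  tuples : (k : ℕ) → List ℕ → List (Vec ℕ k)
  tuples zero    V = [] ∷ []
  tuples (suc k) V = concatMap (λ x → map (x ∷_) (tuples k V)) V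

  ∈-tuples⁺ : ∀ {k V} (xs : Vec ℕ k) → AllIn (toList xs) V → xs ∈ tuples k V
  ∈-tuples⁺ []       _          = here refl
  ∈-tuples⁺ {suc k} {V} (x ∷ xs) (x∈ ∷ xs∈) =
    ∈-concatMap⁺ (λ x → map (x ∷_) (tuples k V)) (lose x∈ (∈-map⁺ (x ∷_) (∈-tuples⁺ xs xs∈)))

  ∈-tuples⁻ : ∀ {k V} (xs : Vec ℕ k) → xs ∈ tuples k V → AllIn (toList xs) V
  ∈-tuples⁻ []       _ = []
  ∈-tuples⁻ {suc k} {V} (x ∷ xs) p with find (∈-concatMap⁻ (λ x → map (x ∷_) (tuples k V)) {xs = V} p)
  ... | y , y∈ , q with ∈-map⁻ (y ∷_) q
  ...   | ys , ys∈ , refl = y∈ ∷ ∈-tuples⁻ ys ys∈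

  -- Partial isomorphisms and the back-and-forth step

  record Agree (Rs : List Symbol) (V : List ℕ) (e e′ : Env) : Set where
    constructor agree
    field
      agree-≡     : ∀ i j → i ∈ V → j ∈ V → Iff (e i ≡ e j) (e′ i ≡ e′ j)
      agree-holds : ∀ r → r ∈ Rs → (xs : Vec ℕ (arity r)) → AllIn (toList xs) V →
                    Iff (Holds r (map e (toList xs))) (Holds r (map e′ (toList xs)))
  open Agree

  Agree-sym : ∀ {Rs V e e′} → Agree Rs V e e′ → Agree Rs V e′ e
  Agree-sym ag = agree (λ i j i∈ j∈ → Iff-sym (agree-≡ ag i j i∈ j∈))
                       (λ r r∈ xs xs∈ → Iff-sym (agree-holds ag r r∈ xs xs∈))

  Agree-reindex : ∀ {Rs V W e e′ f f′} (σ : ℕ → ℕ) → (∀ x → x ∈ W → σ x ∈ V) →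
    (∀ x → x ∈ W → f x ≡ e (σ x)) → (∀ x → x ∈ W → f′ x ≡ e′ (σ x)) →
    Agree Rs V e e′ → Agree Rs W f f′
  Agree-reindex {Rs} {V} {W} {e} {e′} {f} {f′} σ σ∈ f≡ f′≡ ag = agree ≡-part holds-part
    where
    ≡-part : ∀ i j → i ∈ W → j ∈ W → Iff (f i ≡ f j) (f′ i ≡ f′ j)
    ≡-part i j i∈ j∈ rewrite f≡ i i∈ | f≡ j j∈ | f′≡ i i∈ | f′≡ j j∈ =
      agree-≡ ag (σ i) (σ j) (σ∈ i i∈) (σ∈ j j∈)

    through-σ : ∀ (g h : Env) → (∀ x → x ∈ W → g x ≡ h (σ x)) → ∀ {k} (xs : Vec ℕ k) →
      AllIn (toList xs) W → map g (toList xs) ≡ map h (toList (Vec.map σ xs))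
    through-σ g h g≡ xs xs∈ = begin
      map g (toList xs)             ≡⟨ map-cong-local (All.map (g≡ _) xs∈) ⟩
      map (h ∘ σ) (toList xs)       ≡⟨ map-∘ (toList xs) ⟩
      map h (map σ (toList xs))     ≡⟨ cong (map h) (sym (toList-map σ xs)) ⟩
      map h (toList (Vec.map σ xs))   ∎

    holds-part : ∀ r → r ∈ Rs → (xs : Vec ℕ (arity r)) → AllIn (toList xs) W →
      Iff (Holds r (map f (toList xs))) (Holds r (map f′ (toList xs)))
    holds-part r r∈ xs xs∈ rewrite through-σ f e f≡ xs xs∈ | through-σ f′ e′ f′≡ xs xs∈ =
      agree-holds ag r r∈ (Vec.map σ xs)
        (subst (λ ys → AllIn ys V) (sym (toList-map σ xs)) (All.map⁺ (All.map (σ∈ _) xs∈)))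

  liftVars : List ℕ → List ℕ
  liftVars V = 0 ∷ map suc V

  ∈liftVars⁻ : ∀ {V x} → x ∈ liftVars V → x ≡ 0 ⊎ Σ ℕ λ y → y ∈ V × x ≡ suc y
  ∈liftVars⁻ (here refl) = inj₁ refl
  ∈liftVars⁻ (there p) with ∈-map⁻ suc p
  ... | y , y∈ , refl = inj₂ (y , y∈ , refl)

  maxTagOn : Env → List ℕ → ℕ
  maxTagOn e []      = 0
  maxTagOn e (v ∷ V) = maxTag (e v) ⊔ maxTagOn e V

  maxTag≤maxTagOn : ∀ e {V v} → v ∈ V → maxTag (e v) ≤ maxTagOn e V
  maxTag≤maxTagOn e (here refl) = m≤m⊔n _ _
  maxTag≤maxTagOn e {w ∷ _} (there p) = ≤-trans (maxTag≤maxTagOn e p) (m≤n⊔m (maxTag (e w)) _)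

  -- The partner of an element a not named by V: a new element, tagged above everything
  -- e′ names on V, witnessing exactly the Rs-facts that a satisfies together with V.
  module FreshWitness {Rs V e e′} (ag : Agree Rs V e e′) (a : Elem) (a∉ : ¬ Any (λ v → a ≡ e v) V) where

    entry : ℕ → Maybe Elem
    entry zero    = nothing
    entry (suc y) = just (e′ y)

    witnessed : Symbol → List Fact
    witnessed r = map (λ xs → fact r (map entry (toList xs)))
                      (filter (λ xs → holds? r (map (a ∷′ e) (toList xs))) (tuples (arity r) (liftVars V)))

    a′ : Elem
    a′ = elem (suc (maxTagOn e′ V)) (concatMap witnessed Rs)

    maxTag<a′ : ∀ {v} → v ∈ V → maxTag (e′ v) < maxTag a′
    maxTag<a′ v∈ = <-≤-trans (s≤s (maxTag≤maxTagOn e′ v∈)) (m≤m⊔n _ (maxTag-facts (concatMap witnessed Rs)))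

    a′≢ : ∀ {v} → v ∈ V → a′ ≢ e′ v
    a′≢ v∈ a′≡ = <-irrefl (cong maxTag (sym a′≡)) (maxTag<a′ v∈)

    a′-notOccurs : ∀ {v} → v ∈ V → ¬ OccursIn a′ (e′ v)
    a′-notOccurs {v} v∈ occ = <-irrefl refl (<-≤-trans (maxTag<a′ v∈) (occursIn⇒maxTag≤ a′ (e′ v) occ))

    a≢ : ∀ {v} → v ∈ V → a ≢ e v
    a≢ v∈ a≡ = a∉ (lose v∈ a≡)

    ≡-agree : ∀ i j → i ∈ liftVars V → j ∈ liftVars V →
      Iff ((a ∷′ e) i ≡ (a ∷′ e) j) ((a′ ∷′ e′) i ≡ (a′ ∷′ e′) j)
    ≡-agree i j i∈ j∈ with ∈liftVars⁻ i∈ | ∈liftVars⁻ j∈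
    ... | inj₁ refl              | inj₁ refl              = (λ _ → refl) , (λ _ → refl)
    ... | inj₁ refl              | inj₂ (y , y∈ , refl)   = ⊥-elim ∘ a≢ y∈ , ⊥-elim ∘ a′≢ y∈
    ... | inj₂ (y , y∈ , refl)   | inj₁ refl              = ⊥-elim ∘ a≢ y∈ ∘ sym , ⊥-elim ∘ a′≢ y∈ ∘ sym
    ... | inj₂ (y , y∈ , refl)   | inj₂ (y′ , y′∈ , refl) = agree-≡ ag y y′ y∈ y′∈

    map-entry-reflects : ∀ ys zs → AllIn ys (liftVars V) → AllIn zs (liftVars V) →
      map entry ys ≡ map entry zs → map (a ∷′ e) ys ≡ map (a ∷′ e) zs
    map-entry-reflects []       []       _          _          _  = refl
    map-entry-reflects (y ∷ ys) (z ∷ zs) (y∈ ∷ ys∈) (z∈ ∷ zs∈) eq =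
      cong₂ _∷_ (head y z y∈ z∈ (∷-injectiveˡ eq)) (map-entry-reflects ys zs ys∈ zs∈ (∷-injectiveʳ eq))
      where
      head : ∀ y z → y ∈ liftVars V → z ∈ liftVars V → entry y ≡ entry z → (a ∷′ e) y ≡ (a ∷′ e) z
      head zero    zero    _  _  _  = refl
      head zero    (suc _) _  _  ()
      head (suc _) zero    _  _  ()
      head (suc y) (suc z) y∈ z∈ eq with ∈liftVars⁻ y∈ | ∈liftVars⁻ z∈
      ... | inj₂ (_ , y∈V , refl) | inj₂ (_ , z∈V , refl) = proj₂ (agree-≡ ag y z y∈V z∈V) (just-injective eq)
      ... | inj₁ ()               | _
      ... | inj₂ _                | inj₁ ()

    masked-a′ : ∀ xs → AllIn xs (liftVars V) → map (mask a′) (map (a′ ∷′ e′) xs) ≡ map entry xs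
    masked-a′ xs xs∈ = trans (sym (map-∘ xs)) (map-cong-local (All.map (λ {x} → pointwise x) xs∈))
      where
      pointwise : ∀ x → x ∈ liftVars V → mask a′ ((a′ ∷′ e′) x) ≡ entry x
      pointwise x x∈ with ∈liftVars⁻ x∈
      ... | inj₁ refl            = mask-self a′
      ... | inj₂ (y , y∈ , refl) = mask-other a′ (e′ y) (a′≢ y∈ ∘ sym)

    Agree-shifted : Agree Rs (map suc V) (a ∷′ e) (a′ ∷′ e′)
    Agree-shifted = Agree-reindex pred pred∈ shift≡ shift≡ ag
      where
      pred∈ : ∀ x → x ∈ map suc V → pred x ∈ V
      pred∈ x p with ∈-map⁻ suc p
      ... | _ , y∈ , refl = y∈

      shift≡ : ∀ {b} {g : Env} x → x ∈ map suc V → (b ∷′ g) x ≡ g (pred x)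
      shift≡ x p with ∈-map⁻ suc p
      ... | _ , _ , refl = refl

    witness-forth : ∀ r → r ∈ Rs → (xs : Vec ℕ (arity r)) → AllIn (toList xs) (liftVars V) →
      0 ∈ toList xs → Holds r (map (a ∷′ e) (toList xs)) → Holds r (map (a′ ∷′ e′) (toList xs))
    witness-forth r r∈ xs xs∈ 0∈ h =
      lose (∈-map⁺ (a′ ∷′ e′) 0∈)
        (subst (λ ys → fact r ys ∈ claims a′) (sym (masked-a′ (toList xs) xs∈)) claimed)
      where
      claimed : fact r (map entry (toList xs)) ∈ claims a′
      claimed = ∈-concatMap⁺ witnessed (lose r∈ (∈-map⁺ (λ xs → fact r (map entry (toList xs)))
                  (∈-filter⁺ (λ xs → holds? r (map (a ∷′ e) (toList xs))) (∈-tuples⁺ xs xs∈) h)))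

    claims-a′⇒holds : ∀ r (xs : Vec ℕ (arity r)) → AllIn (toList xs) (liftVars V) →
      fact r (map entry (toList xs)) ∈ claims a′ → Holds r (map (a ∷′ e) (toList xs))
    claims-a′⇒holds r xs xs∈ claimed with find (∈-concatMap⁻ witnessed {xs = Rs} claimed)
    ... | r′ , _ , p with ∈-map⁻ (λ ys → fact r′ (map entry (toList ys))) p
    ... | ys , ys∈ , fact≡ with fact-injective fact≡
    ... | refl , entries≡
      with ∈-filter⁻ (λ ys → holds? r (map (a ∷′ e) (toList ys))) {xs = tuples (arity r) (liftVars V)} ys∈
    ... | ys∈tuples , holds-ys = subst (Holds r)
      (map-entry-reflects (toList ys) (toList xs) (∈-tuples⁻ ys ys∈tuples) xs∈ (sym entries≡)) holds-ys

    witness-back : ∀ r (xs : Vec ℕ (arity r)) → AllIn (toList xs) (liftVars V) →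
      0 ∈ toList xs → Holds r (map (a′ ∷′ e′) (toList xs)) → Holds r (map (a ∷′ e) (toList xs))
    witness-back r xs xs∈ 0∈ h with find h
    ... | c , c∈ , c-claims with ∈-map⁻ (a′ ∷′ e′) c∈
    ... | x , x∈ , refl with ∈liftVars⁻ (All.lookup xs∈ x∈)
    ... | inj₁ refl =
      claims-a′⇒holds r xs xs∈ (subst (λ ys → fact r ys ∈ claims a′) (masked-a′ (toList xs) xs∈) c-claims)
    ... | inj₂ (y , y∈ , refl) = ⊥-elim (a′-notOccurs y∈ (lose c-claims a′-entry))
      where
      a′-entry : just a′ ∈ map (mask (e′ y)) (map (a′ ∷′ e′) (toList xs))
      a′-entry = subst (_∈ map (mask (e′ y)) (map (a′ ∷′ e′) (toList xs)))
                       (mask-other (e′ y) a′ (a′≢ y∈)) (∈-map⁺ (mask (e′ y)) (∈-map⁺ (a′ ∷′ e′) 0∈))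

    Agree-lifted : Agree Rs (liftVars V) (a ∷′ e) (a′ ∷′ e′)
    Agree-lifted = agree ≡-agree holds-agree
      where
      holds-agree : ∀ r → r ∈ Rs → (xs : Vec ℕ (arity r)) → AllIn (toList xs) (liftVars V) →
        Iff (Holds r (map (a ∷′ e) (toList xs))) (Holds r (map (a′ ∷′ e′) (toList xs)))
      holds-agree r r∈ xs xs∈ with 0 ∈ℕ? toList xs
      ... | yes 0∈ = witness-forth r r∈ xs xs∈ 0∈ , witness-back r xs xs∈ 0∈
      ... | no 0∉  = agree-holds Agree-shifted r r∈ xs (All.tabulate λ x∈ → shifted x∈ (All.lookup xs∈ x∈))
        where
        shifted : ∀ {x} → x ∈ toList xs → x ∈ liftVars V → x ∈ map suc V
        shifted x∈ (here refl) = ⊥-elim (0∉ x∈)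
        shifted x∈ (there p)   = p

  extend : ∀ {Rs V e e′} → Agree Rs V e e′ → (a : Elem) →
    Σ Elem λ a′ → Agree Rs (liftVars V) (a ∷′ e) (a′ ∷′ e′)
  extend {V = V} {e} {e′} ag a with any? (λ v → a ≟ᵉ e v) V
  ... | no a∉ = FreshWitness.a′ ag a a∉ , FreshWitness.Agree-lifted ag a a∉
  ... | yes a∈ with find a∈
  ...   | v , v∈ , a≡ = e′ v , Agree-reindex σ σ∈ (≡σ a≡) (≡σ refl) ag
    where
    σ : ℕ → ℕ
    σ zero    = v
    σ (suc y) = y

    σ∈ : ∀ x → x ∈ liftVars V → σ x ∈ V
    σ∈ x x∈ with ∈liftVars⁻ x∈
    ... | inj₁ refl            = v∈
    ... | inj₂ (_ , y∈ , refl) = y∈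

    ≡σ : ∀ {b} {g : Env} → b ≡ g v → ∀ x → x ∈ liftVars V → (b ∷′ g) x ≡ g (σ x)
    ≡σ b≡ zero    _ = b≡
    ≡σ b≡ (suc _) _ = refl

  UsesOnly : List Symbol → Fm → Set
  UsesOnly Rs ⊥'         = ⊤
  UsesOnly Rs (rel r _)  = r ∈ Rs
  UsesOnly Rs (_ ≈' _)   = ⊤
  UsesOnly Rs (φ ⇒ ψ)    = UsesOnly Rs φ × UsesOnly Rs ψ
  UsesOnly Rs (∀' φ)     = UsesOnly Rs φ

  FreeIn : Fm → List ℕ → Set
  FreeIn φ V = ∀ x → freeF x φ → x ∈ V

  varsOf⊆ : ∀ {k V} (ts : Vec Tm k) → (∀ x → freeTs x ts → x ∈ V) → AllIn (toList (varsOf ts)) V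
  varsOf⊆ ts fv = All.tabulate λ x∈ → fv _ (∈varsOf⇒freeTs ts x∈)

  Agree⇒⊨ : ∀ {Rs V} φ → UsesOnly Rs φ → FreeIn φ V → ∀ {e e′} → Agree Rs V e e′ → e ⊨ φ → e′ ⊨ φ
  Agree⇒⊨ ⊥'               _  _  _  s = s
  Agree⇒⊨ (rel r ts)       r∈ fv {e} {e′} ag s = λ k → s λ h → k
    (subst (Holds r) (sym (evalTs-varsOf e′ ts))
      (proj₁ (agree-holds ag r r∈ (varsOf ts) (varsOf⊆ ts fv)) (subst (Holds r) (evalTs-varsOf e ts) h)))
  Agree⇒⊨ (var i ≈' var j) _  fv ag s = λ k → s λ i≡j → k
    (proj₁ (agree-≡ ag i j (fv i (inj₁ refl)) (fv j (inj₂ refl))) i≡j)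
  Agree⇒⊨ (app () _ ≈' _)     _ _ _ _
  Agree⇒⊨ (var _ ≈' app () _) _ _ _ _
  Agree⇒⊨ (φ ⇒ ψ) (uφ , uψ) fv ag s = λ sφ →
    Agree⇒⊨ ψ uψ (λ x p → fv x (inj₂ p)) ag (s (Agree⇒⊨ φ uφ (λ x p → fv x (inj₁ p)) (Agree-sym ag) sφ))
  Agree⇒⊨ (∀' φ) u fv ag s a′ with extend (Agree-sym ag) a′
  ... | a , ag′ = Agree⇒⊨ φ u fv′ (Agree-sym ag′) (s a)
    where
    fv′ : FreeIn φ (liftVars _)
    fv′ zero    _ = here refl
    fv′ (suc x) p = there (∈-map⁺ suc (fv x p))

  -- Elimination of quantifiers

  symbols : Fm → List Symbol
  symbols ⊥'         = []
  symbols (rel r _)  = r ∷ []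
  symbols (_ ≈' _)   = []
  symbols (φ ⇒ ψ)    = symbols φ ++ symbols ψ
  symbols (∀' φ)     = symbols φ

  UsesOnly-mono : ∀ {Rs Rs′} → (∀ {r} → r ∈ Rs → r ∈ Rs′) → ∀ φ → UsesOnly Rs φ → UsesOnly Rs′ φ
  UsesOnly-mono sub ⊥'        _          = tt
  UsesOnly-mono sub (rel r _) r∈         = sub r∈
  UsesOnly-mono sub (_ ≈' _)  _          = tt
  UsesOnly-mono sub (φ ⇒ ψ)   (uφ , uψ)  = UsesOnly-mono sub φ uφ , UsesOnly-mono sub ψ uψ
  UsesOnly-mono sub (∀' φ)    u          = UsesOnly-mono sub φ u

  UsesOnly-symbols : ∀ φ → UsesOnly (symbols φ) φ
  UsesOnly-symbols ⊥'        = tt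
  UsesOnly-symbols (rel r _) = here refl
  UsesOnly-symbols (_ ≈' _)  = tt
  UsesOnly-symbols (φ ⇒ ψ)   = UsesOnly-mono ∈-++⁺ˡ φ (UsesOnly-symbols φ)
                              , UsesOnly-mono (∈-++⁺ʳ (symbols φ)) ψ (UsesOnly-symbols ψ)
  UsesOnly-symbols (∀' φ)    = UsesOnly-symbols φ

  FreeBelow : ℕ → Fm → Set
  FreeBelow p φ = ∀ x → freeF x φ → x < p

  varBoundTs : ∀ {k} → Vec Tm k → ℕ
  varBoundTs []             = 0
  varBoundTs (var x ∷ ts)   = suc x ⊔ varBoundTs ts
  varBoundTs (app () _ ∷ _)

  varBound : Fm → ℕ
  varBound ⊥'                 = 0
  varBound (rel _ ts)         = varBoundTs ts
  varBound (var i ≈' var j)   = suc i ⊔ suc j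
  varBound (app () _ ≈' _)
  varBound (var _ ≈' app () _)
  varBound (φ ⇒ ψ)            = varBound φ ⊔ varBound ψ
  varBound (∀' φ)             = pred (varBound φ)

  FreeBelow-varBound : ∀ φ → FreeBelow (varBound φ) φ
  FreeBelow-varBound ⊥'               x ()
  FreeBelow-varBound (rel _ ts)       x p = free-ts ts p
    where
    free-ts : ∀ {k} (ts : Vec Tm k) → freeTs x ts → x < varBoundTs ts
    free-ts (var _ ∷ ts) (inj₁ refl) = m≤m⊔n _ (varBoundTs ts)
    free-ts (var y ∷ ts) (inj₂ p)    = ≤-trans (free-ts ts p) (m≤n⊔m (suc y) _)
    free-ts (app () _ ∷ _) _
  FreeBelow-varBound (var i ≈' var j) x (inj₁ refl) = m≤m⊔n (suc i) (suc j)
  FreeBelow-varBound (var i ≈' var j) x (inj₂ refl) = m≤n⊔m (suc i) (suc j)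
  FreeBelow-varBound (app () _ ≈' _)     x _
  FreeBelow-varBound (var _ ≈' app () _) x _
  FreeBelow-varBound (φ ⇒ ψ) x (inj₁ p) = ≤-trans (FreeBelow-varBound φ x p) (m≤m⊔n _ _)
  FreeBelow-varBound (φ ⇒ ψ) x (inj₂ p) = ≤-trans (FreeBelow-varBound ψ x p) (m≤n⊔m (varBound φ) _)
  FreeBelow-varBound (∀' φ)  x p        = <⇒≤pred (FreeBelow-varBound φ (suc x) p)

  eqAtoms : List ℕ → List Fm
  eqAtoms V = concatMap (λ i → map (λ j → var i ≈' var j) V) V

  relAtoms : List Symbol → List ℕ → List Fm
  relAtoms Rs V = concatMap (λ r → map (λ xs → rel r (Vec.map var xs)) (tuples (arity r) V)) Rs

  atoms : List Symbol → List ℕ → List Fm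
  atoms Rs V = eqAtoms V ++ relAtoms Rs V

  data IsAtom (V : List ℕ) : Fm → Set where
    eqAtom  : ∀ {i j} → i ∈ V → j ∈ V → IsAtom V (var i ≈' var j)
    relAtom : ∀ r (xs : Vec ℕ (arity r)) → AllIn (toList xs) V → IsAtom V (rel r (Vec.map var xs))

  ∈eqAtoms : ∀ {V i j} → i ∈ V → j ∈ V → (var i ≈' var j) ∈ eqAtoms V
  ∈eqAtoms {V} {i} i∈ j∈ =
    ∈-concatMap⁺ (λ i → map (λ j → var i ≈' var j) V) (lose i∈ (∈-map⁺ (λ j → var i ≈' var j) j∈))

  ∈relAtoms : ∀ {Rs V r} (xs : Vec ℕ (arity r)) → r ∈ Rs → AllIn (toList xs) V →
    rel r (Vec.map var xs) ∈ relAtoms Rs V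
  ∈relAtoms {Rs} {V} {r} xs r∈ xs∈ =
    ∈-concatMap⁺ (λ r → map (λ xs → rel r (Vec.map var xs)) (tuples (arity r) V))
      (lose r∈ (∈-map⁺ (λ xs → rel r (Vec.map var xs)) (∈-tuples⁺ xs xs∈)))

  ∈atoms⇒IsAtom : ∀ {Rs V φ} → φ ∈ atoms Rs V → IsAtom V φ
  ∈atoms⇒IsAtom {Rs} {V} p with ∈-++⁻ (eqAtoms V) p
  ... | inj₁ q with find (∈-concatMap⁻ (λ i → map (λ j → var i ≈' var j) V) {xs = V} q)
  ...   | i , i∈ , q′ with ∈-map⁻ (λ j → var i ≈' var j) q′
  ...     | j , j∈ , refl = eqAtom i∈ j∈
  ∈atoms⇒IsAtom {Rs} {V} p | inj₂ q
    with find (∈-concatMap⁻ (λ r → map (λ xs → rel r (Vec.map var xs)) (tuples (arity r) V)) {xs = Rs} q)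
  ...   | r , _ , q′ with ∈-map⁻ (λ xs → rel r (Vec.map var xs)) q′
  ...     | xs , xs∈ , refl = relAtom r xs (∈-tuples⁻ xs xs∈)

  IsAtom⇒FreeIn : ∀ {V φ} → IsAtom V φ → FreeIn φ V
  IsAtom⇒FreeIn (eqAtom i∈ j∈)       _ (inj₁ refl) = i∈
  IsAtom⇒FreeIn (eqAtom i∈ j∈)       _ (inj₂ refl) = j∈
  IsAtom⇒FreeIn (relAtom r xs xs∈)   x p           = All.lookup xs∈ (freeTs-var⇒∈ xs p)

  SameTruth : List Fm → Env → Env → Set
  SameTruth φs e e′ = All (λ φ → Iff (e ⊨ φ) (e′ ⊨ φ)) φs

  SameTruth-atoms⇒Agree : ∀ {Rs V e e′} → SameTruth (atoms Rs V) e e′ → Agree Rs V e e′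
  SameTruth-atoms⇒Agree {Rs} {V} {e} {e′} same = agree ≡-part holds-part
    where
    ≡-part : ∀ i j → i ∈ V → j ∈ V → Iff (e i ≡ e j) (e′ i ≡ e′ j)
    ≡-part i j i∈ j∈ with All.lookup same (∈-++⁺ˡ (∈eqAtoms i∈ j∈))
    ... | f , g = (λ i≡j → decidable-stable (e′ i ≟ᵉ e′ j) (f (λ k → k i≡j)))
                , (λ i≡j → decidable-stable (e i ≟ᵉ e j) (g (λ k → k i≡j)))

    holds-part : ∀ r → r ∈ Rs → (xs : Vec ℕ (arity r)) → AllIn (toList xs) V →
      Iff (Holds r (map e (toList xs))) (Holds r (map e′ (toList xs)))
    holds-part r r∈ xs xs∈ with All.lookup same (∈-++⁺ʳ (eqAtoms V) (∈relAtoms xs r∈ xs∈))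
    ... | f , g = transfer e e′ f , transfer e′ e g
      where
      transfer : ∀ (d d′ : Env) → (d ⊨ rel r (Vec.map var xs) → d′ ⊨ rel r (Vec.map var xs)) →
        Holds r (map d (toList xs)) → Holds r (map d′ (toList xs))
      transfer d d′ f h = subst (Holds r) (evalTs-var d′ xs)
        (decidable-stable (holds? r _) (f λ k → k (subst (Holds r) (sym (evalTs-var d xs)) h)))

  infixr 6 _∧′_
  _∧′_ : Fm → Fm → Fm
  φ ∧′ ψ = (φ ⇒ (ψ ⇒ ⊥')) ⇒ ⊥'

  ¬′_ : Fm → Fm
  ¬′ φ = φ ⇒ ⊥'

  ⋀ : List Fm → Fm
  ⋀ []       = ⊥' ⇒ ⊥'
  ⋀ (φ ∷ φs) = φ ∧′ ⋀ φs

  ∧′-fst : ∀ e φ ψ → e ⊨ φ ∧′ ψ → e ⊨ φ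
  ∧′-fst e φ ψ s = ⊨-stable e φ (λ k → s (λ sφ _ → k sφ))

  ∧′-snd : ∀ e φ ψ → e ⊨ φ ∧′ ψ → e ⊨ ψ
  ∧′-snd e φ ψ s = ⊨-stable e ψ (λ k → s (λ _ sψ → k sψ))

  ⋀-intro : ∀ e φs → All (e ⊨_) φs → e ⊨ ⋀ φs
  ⋀-intro e []       []         = id
  ⋀-intro e (φ ∷ φs) (sφ ∷ sφs) = λ k → k sφ (⋀-intro e φs sφs)

  ⋀-elim : ∀ e φs → e ⊨ ⋀ φs → All (e ⊨_) φs
  ⋀-elim e []       _ = []
  ⋀-elim e (φ ∷ φs) s = ∧′-fst e φ (⋀ φs) s ∷ ⋀-elim e φs (∧′-snd e φ (⋀ φs) s)

  BoolComb-∧′ : ∀ {ℓ} {B : Fm → Set ℓ} {φ ψ} → BoolComb B φ → BoolComb B ψ → BoolComb B (φ ∧′ ψ)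
  BoolComb-∧′ bφ bψ = imp (imp bφ (imp bψ bot)) bot

  BoolComb-¬′ : ∀ {ℓ} {B : Fm → Set ℓ} {φ} → BoolComb B φ → BoolComb B (¬′ φ)
  BoolComb-¬′ bφ = imp bφ bot

  ∀ⁿ : ℕ → Fm → Fm
  ∀ⁿ zero    θ = θ
  ∀ⁿ (suc p) θ = ∀' (∀ⁿ p θ)

  -- overlay p g env reads the variables below p from g and the others, shifted by p, from env.
  overlay : ℕ → Env → Env → Env
  overlay zero    g env = env
  overlay (suc p) g env = overlay p g (g p ∷′ env)

  overlay-above : ∀ p g env j → overlay p g env (p + j) ≡ env j
  overlay-above zero    g env j = refl
  overlay-above (suc p) g env j =
    trans (cong (overlay p g (g p ∷′ env)) (sym (+-suc p j))) (overlay-above p g (g p ∷′ env) (suc j))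

  overlay-below : ∀ p g env i → i < p → overlay p g env i ≡ g i
  overlay-below (suc p) g env i i<1+p with m<1+n⇒m<n∨m≡n i<1+p
  ... | inj₁ i<p  = overlay-below p g (g p ∷′ env) i i<p
  ... | inj₂ refl =
    trans (cong (overlay p g (g p ∷′ env)) (sym (+-identityʳ p))) (overlay-above p g (g p ∷′ env) 0)

  overlay-cong : ∀ p g g′ env env′ → (∀ i → i < p → g i ≡ g′ i) → (∀ x → env x ≡ env′ x) →
    ∀ x → overlay p g env x ≡ overlay p g′ env′ x
  overlay-cong zero    g g′ env env′ g≡ env≡ = env≡
  overlay-cong (suc p) g g′ env env′ g≡ env≡ =
    overlay-cong p g g′ (g p ∷′ env) (g′ p ∷′ env′) (λ i i<p → g≡ i (m<n⇒m<1+n i<p)) head≡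
    where
    head≡ : ∀ x → (g p ∷′ env) x ≡ (g′ p ∷′ env′) x
    head≡ zero    = g≡ p (n<1+n p)
    head≡ (suc x) = env≡ x

  update : Env → ℕ → Elem → Env
  update g p a i with i ≟ p
  ... | yes _ = a
  ... | no _  = g i

  update-hit : ∀ g p a → update g p a p ≡ a
  update-hit g p a with p ≟ p
  ... | yes _  = refl
  ... | no p≢p = ⊥-elim (p≢p refl)

  update-below : ∀ g p a i → i < p → update g p a i ≡ g i
  update-below g p a i i<p with i ≟ p
  ... | yes refl = ⊥-elim (<-irrefl refl i<p)
  ... | no _     = refl

  ∀ⁿ-elim : ∀ p θ env → env ⊨ ∀ⁿ p θ → ∀ g → overlay p g env ⊨ θ
  ∀ⁿ-elim zero    θ env s g = s
  ∀ⁿ-elim (suc p) θ env s g = ∀ⁿ-elim p θ (g p ∷′ env) (s (g p)) g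

  ∀ⁿ-intro : ∀ p θ env → (∀ g → overlay p g env ⊨ θ) → env ⊨ ∀ⁿ p θ
  ∀ⁿ-intro zero    θ env s   = s (λ _ → env 0)
  ∀ⁿ-intro (suc p) θ env s a = ∀ⁿ-intro p θ (a ∷′ env) λ g →
    ⊨-coincide θ _ _ (λ x _ → overlay-cong p (update g p a) g _ _ (update-below g p a) (head≡ g) x)
      (s (update g p a))
    where
    head≡ : ∀ g x → (update g p a p ∷′ env) x ≡ (a ∷′ env) x
    head≡ g zero    = update-hit g p a
    head≡ g (suc x) = refl

  Closed : Fm → Set
  Closed φ = ∀ x → ¬ freeF x φ

  ∀ⁿ-closed : ∀ p θ → FreeBelow p θ → Closed (∀ⁿ p θ)
  ∀ⁿ-closed p θ below x free = <-irrefl refl (≤-<-trans (m≤n+m p x) (below (x + p) (free-∀ⁿ p x free)))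
    where
    free-∀ⁿ : ∀ p x → freeF x (∀ⁿ p θ) → freeF (x + p) θ
    free-∀ⁿ zero    x fr = subst (λ z → freeF z θ) (sym (+-identityʳ x)) fr
    free-∀ⁿ (suc p) x fr = subst (λ z → freeF z θ) (sym (+-suc x p)) (free-∀ⁿ p (suc x) fr)

  ⋀-FreeBelow : ∀ p φs → All (FreeBelow p) φs → FreeBelow p (⋀ φs)
  ⋀-FreeBelow p []       _          x (inj₁ ())
  ⋀-FreeBelow p []       _          x (inj₂ ())
  ⋀-FreeBelow p (φ ∷ φs) (bφ ∷ _)   x (inj₁ (inj₁ q))         = bφ x q
  ⋀-FreeBelow p (φ ∷ φs) (_ ∷ bφs)  x (inj₁ (inj₂ (inj₁ q))) = ⋀-FreeBelow p φs bφs x q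
  ⋀-FreeBelow p (φ ∷ φs) _          x (inj₁ (inj₂ (inj₂ ())))
  ⋀-FreeBelow p (φ ∷ φs) _          x (inj₂ ())

  ¬′-FreeBelow : ∀ p φ → FreeBelow p φ → FreeBelow p (¬′ φ)
  ¬′-FreeBelow p φ bφ x (inj₁ q) = bφ x q

  -- φ is equivalent to the decision tree over a list of atoms whose leaf, on a branch C of
  -- literals, is the sentence ∀x̄ (⋀ C → φ).  Once C decides every atom, any two assignments
  -- satisfying C agree, so they agree on φ by Agree⇒⊨.
  module DecisionTree (φ : Fm) (p : ℕ) where

    tree : List Fm → List Fm → Fm
    tree []       C = ∀ⁿ p (⋀ C ⇒ φ)
    tree (a ∷ As) C = (a ⇒ tree As (a ∷ C)) ∧′ (¬′ a ⇒ tree As (¬′ a ∷ C))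

    ⊨tree : ∀ {Rs V} → UsesOnly Rs φ → FreeIn φ V → ∀ e → e ⊨ φ → ∀ As C → All (e ⊨_) C →
      (∀ e′ → All (e′ ⊨_) C → SameTruth As e e′ → Agree Rs V e e′) → e ⊨ tree As C
    ⊨tree u fv e sφ [] C _ decided =
      ∀ⁿ-intro p _ e λ g sC → Agree⇒⊨ φ u fv (decided (overlay p g e) (⋀-elim _ C sC) []) sφ
    ⊨tree {Rs} {V} u fv e sφ (a ∷ As) C sC decided = λ k →
      k (λ sa → ⊨tree u fv e sφ As (a ∷ C) (sa ∷ sC) (decided⁺ sa))
        (λ s¬a → ⊨tree u fv e sφ As (¬′ a ∷ C) (s¬a ∷ sC) (decided⁻ s¬a))
      where
      decided⁺ : e ⊨ a → ∀ e′ → All (e′ ⊨_) (a ∷ C) → SameTruth As e e′ → Agree Rs V e e′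
      decided⁺ sa e′ (sa′ ∷ sC′) same = decided e′ sC′ (((λ _ → sa′) , (λ _ → sa)) ∷ same)

      decided⁻ : e ⊨ ¬′ a → ∀ e′ → All (e′ ⊨_) (¬′ a ∷ C) → SameTruth As e e′ → Agree Rs V e e′
      decided⁻ s¬a e′ (s¬a′ ∷ sC′) same = decided e′ sC′ ((⊥-elim ∘ s¬a , ⊥-elim ∘ s¬a′) ∷ same)

    ⊨tree-∷⁻ : ∀ e a As C → e ⊨ tree (a ∷ As) C →
      (e ⊨ a → e ⊨ tree As (a ∷ C)) × (e ⊨ ¬′ a → e ⊨ tree As (¬′ a ∷ C))
    ⊨tree-∷⁻ e a As C s = ∧′-fst e pos neg s , ∧′-snd e pos neg s
      where
      pos neg : Fm
      pos = a ⇒ tree As (a ∷ C)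
      neg = ¬′ a ⇒ tree As (¬′ a ∷ C)

    tree⇒⊨ : FreeBelow p φ → ∀ e As C → e ⊨ tree As C → All (e ⊨_) C →
      All (FreeBelow p) C → All (FreeBelow p) As → e ⊨ φ
    tree⇒⊨ bφ e [] C s sC bC _ =
      ⊨-coincide φ (overlay p e e) e (λ x fr → overlay-below p e e x (bφ x fr))
        (∀ⁿ-elim p _ e s e (⋀-intro _ C (onOverlay C bC sC)))
      where
      onOverlay : ∀ C → All (FreeBelow p) C → All (e ⊨_) C → All (overlay p e e ⊨_) C
      onOverlay []      _          _          = []
      onOverlay (c ∷ C) (bc ∷ bC) (sc ∷ sC) =
        ⊨-coincide c e _ (λ x fr → sym (overlay-below p e e x (bc x fr))) sc ∷ onOverlay C bC sC
    tree⇒⊨ bφ e (a ∷ As) C s sC bC (ba ∷ bAs) = ⊨-byCases e φ (e ⊨ a)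
      (λ sa → tree⇒⊨ bφ e As (a ∷ C) (proj₁ (⊨tree-∷⁻ e a As C s) sa) (sa ∷ sC) (ba ∷ bC) bAs)
      (λ s¬a → tree⇒⊨ bφ e As (¬′ a ∷ C) (proj₂ (⊨tree-∷⁻ e a As C s) s¬a) (s¬a ∷ sC)
                 (¬′-FreeBelow p a ba ∷ bC) bAs)

    tree-BoolComb : ∀ {V} As C → All (IsAtom V) As → All (FreeBelow p) As → All (FreeBelow p) C →
      FreeBelow p φ → BoolComb (λ χ → IsAtom V χ ⊎ Closed χ) (tree As C)
    tree-BoolComb [] C _ _ bC bφ = base (inj₂ (∀ⁿ-closed p _ below))
      where
      below : FreeBelow p (⋀ C ⇒ φ)
      below x (inj₁ q) = ⋀-FreeBelow p C bC x q
      below x (inj₂ q) = bφ x q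
    tree-BoolComb (a ∷ As) C (ia ∷ iAs) (ba ∷ bAs) bC bφ = BoolComb-∧′
      (imp (base (inj₁ ia)) (tree-BoolComb As (a ∷ C) iAs bAs (ba ∷ bC) bφ))
      (imp (BoolComb-¬′ (base (inj₁ ia))) (tree-BoolComb As (¬′ a ∷ C) iAs bAs (¬′-FreeBelow p a ba ∷ bC) bφ))

  atomicNormalForm : ∀ φ → Σ Fm λ ψ →
    BoolComb (λ χ → IsAtom (upTo (varBound φ)) χ ⊎ Closed χ) ψ × (∀ e → Iff (e ⊨ φ) (e ⊨ ψ))
  atomicNormalForm φ = tree As [] , tree-BoolComb As [] isAtom below [] bφ , λ e →
    (λ sφ → ⊨tree (UsesOnly-symbols φ) (λ x fr → ∈-upTo⁺ (bφ x fr)) e sφ As [] []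
              (λ _ _ → SameTruth-atoms⇒Agree))
    , (λ s → tree⇒⊨ bφ e As [] s [] [] below)
    where
    open DecisionTree φ (varBound φ)

    As : List Fm
    As = atoms (symbols φ) (upTo (varBound φ))

    bφ : FreeBelow (varBound φ) φ
    bφ = FreeBelow-varBound φ

    isAtom : All (IsAtom (upTo (varBound φ))) As
    isAtom = All.tabulate (∈atoms⇒IsAtom {symbols φ})

    below : All (FreeBelow (varBound φ)) As
    below = All.map (λ ia x fr → ∈-upTo⁻ (IsAtom⇒FreeIn ia x fr)) isAtom

  BoolComb-map : ∀ {ℓ ℓ′} {B : Fm → Set ℓ} {B′ : Fm → Set ℓ′} → (∀ χ → B χ → B′ χ) →
    ∀ {ψ} → BoolComb B ψ → BoolComb B′ ψ
  BoolComb-map f (base b)  = base (f _ b)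
  BoolComb-map f bot       = bot
  BoolComb-map f (imp p q) = imp (BoolComb-map f p) (BoolComb-map f q)

  EquivBC-atomic : ∀ {ℓ} {B : Fm → Set ℓ} → (∀ V χ → IsAtom V χ ⊎ Closed χ → B χ) → ∀ φ → EquivBC T B φ
  EquivBC-atomic classify φ with atomicNormalForm φ
  ... | ψ , bψ , φ⇔ψ = ψ , BoolComb-map (classify _) bψ , M-equiv⇒TEquiv φ ψ (proj₁ ∘ φ⇔ψ) (proj₂ ∘ φ⇔ψ)

  -- Separating assignments

  -- e and e′ send x_i to the (i ⊓ q)-th of q + 1 distinct elements.  Under e the first of them
  -- witnesses r₀(x₀, …, x_q), under e′ no relation holds at all; a formula that sees fewer
  -- than q + 1 of the variables, or does not mention r₀, cannot tell e and e′ apart.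
  module Separation (r₀ : Symbol) (q : ℕ) where

    witnessEntries : List (Maybe Elem)
    witnessEntries = nothing ∷ applyUpTo (λ j → just (elem (suc j) [])) q

    point : ℕ → Elem
    point zero    = elem 0 (fact r₀ witnessEntries ∷ [])
    point (suc k) = elem (suc k) []

    e e′ : Env
    e  x = point (x ⊓ q)
    e′ x = elem (x ⊓ q) []

    tag-point : ∀ k → tag (point k) ≡ k
    tag-point zero    = refl
    tag-point (suc k) = refl

    ≡-agree : ∀ i j → Iff (e i ≡ e j) (e′ i ≡ e′ j)
    ≡-agree i j =
      (λ ei≡ej → cong (λ k → elem k [])
                   (trans (sym (tag-point (i ⊓ q))) (trans (cong tag ei≡ej) (tag-point (j ⊓ q)))))
      , (λ e′i≡e′j → cong (point ∘ tag) e′i≡e′j)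

    e′-holds-nothing : ∀ r xs → ¬ Holds r (map e′ xs)
    e′-holds-nothing r xs h with find h
    ... | c , c∈ , claimed with ∈-map⁻ e′ c∈
    ... | _ , _ , refl with claimed
    ... | ()

    claims-point : ∀ k {r zs} → fact r zs ∈ claims (point k) → k ≡ 0 × r ≡ r₀ × zs ≡ witnessEntries
    claims-point zero (here eq) with fact-injective eq
    ... | refl , refl = refl , refl , refl

    Covers : List ℕ → Set
    Covers V = ∀ k → k ≤ q → Σ ℕ λ x → x ∈ V × x ⊓ q ≡ k

    e-holds⇒ : ∀ r xs → Holds r (map e xs) → r ≡ r₀ × Covers xs
    e-holds⇒ r xs h with find h
    ... | c , c∈ , claimed with ∈-map⁻ e c∈
    ... | x , x∈ , refl with claims-point (x ⊓ q) claimed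
    ... | x⊓q≡0 , refl , entries≡ = refl , covers
      where
      covers : Covers xs
      covers zero    _      = x , x∈ , x⊓q≡0
      covers (suc j) 1+j≤q with ∈-map⁻ e (∈masked (subst (just (elem (suc j) []) ∈_) (sym entries≡)
                                  (there (∈-applyUpTo⁺ (λ j → just (elem (suc j) [])) 1+j≤q))))
        where
        ∈masked : ∀ {c cs y} → just y ∈ map (mask c) cs → y ∈ cs
        ∈masked {c} {cs} p with ∈-map⁻ (mask c) p
        ... | z , z∈ , eq = subst (_∈ cs) (mask-just c z _ (sym eq)) z∈
      ... | x′ , x′∈ , eq = x′ , x′∈ , trans (sym (tag-point (x′ ⊓ q))) (cong tag (sym eq))

    Agree-e-e′ : ∀ Rs V → r₀ ∉ Rs ⊎ ¬ Covers V → Agree Rs V e e′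
    Agree-e-e′ Rs V blind = agree (λ i j _ _ → ≡-agree i j) holds-part
      where
      holds-part : ∀ r → r ∈ Rs → (xs : Vec ℕ (arity r)) → AllIn (toList xs) V →
        Iff (Holds r (map e (toList xs))) (Holds r (map e′ (toList xs)))
      holds-part r r∈ xs xs∈ =
        (⊥-elim ∘ impossible ∘ e-holds⇒ r (toList xs)) , (⊥-elim ∘ e′-holds-nothing r (toList xs))
        where
        restrict : Covers (toList xs) → Covers V
        restrict covers k k≤q = let x , x∈ , eq = covers k k≤q in x , All.lookup xs∈ x∈ , eq

        impossible : r ≡ r₀ × Covers (toList xs) → ⊥
        impossible (refl , covers) = [ (λ r₀∉ → r₀∉ r∈) , (λ ¬covers → ¬covers (restrict covers)) ] blind

    Blind : Fm → Set
    Blind θ = Iff (e ⊨ θ) (e′ ⊨ θ)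

    Agree⇒Blind : ∀ {Rs V} θ → UsesOnly Rs θ → FreeIn θ V → r₀ ∉ Rs ⊎ ¬ Covers V → Blind θ
    Agree⇒Blind θ u fv blind = Agree⇒⊨ θ u fv ag , Agree⇒⊨ θ u fv (Agree-sym ag)
      where
      ag : Agree _ _ e e′
      ag = Agree-e-e′ _ _ blind

    short⇒¬Covers : ∀ V → length V ≤ q → ¬ Covers V
    short⇒¬Covers V |V|≤q covers =
      let i , j , i<j , same = pigeonhole (s≤s |V|≤q) position in <-irrefl (position-injective i j same) i<j
      where
      witness : ∀ i → Σ ℕ λ x → x ∈ V × x ⊓ q ≡ toℕ i
      witness i = covers (toℕ i) (≤-pred (toℕ<n i))

      position : Fin (suc q) → Fin (length V)
      position i = Any.index (proj₁ (proj₂ (witness i)))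

      position-injective : ∀ i j → position i ≡ position j → toℕ i ≡ toℕ j
      position-injective i j same with witness i | witness j
      ... | x , x∈ , x⊓q≡i | y , y∈ , y⊓q≡j =
        trans (sym x⊓q≡i) (trans (cong (_⊓ q) x≡y) y⊓q≡j)
        where
        x≡y : x ≡ y
        x≡y = trans (lookup-index x∈) (trans (cong (lookup V) same) (sym (lookup-index y∈)))

    e⊨r₀ : ∀ (ts : Vec Tm (arity r₀)) → toList (varsOf ts) ≡ upTo (suc q) → e ⊨ rel r₀ ts
    e⊨r₀ ts vars≡ k = k (subst (Holds r₀) (sym (trans (evalTs-varsOf e ts) (cong (map e) vars≡))) witnessed)
      where
      entry≡ : ∀ j → j < q → mask (point 0) (e (suc j)) ≡ just (elem (suc j) [])
      entry≡ j j<q rewrite m≤n⇒m⊓n≡m j<q = mask-other (point 0) (elem (suc j) []) (λ ())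

      masked≡ : map (mask (point 0)) (map e (upTo (suc q))) ≡ witnessEntries
      masked≡ = cong₂ _∷_ (mask-self (point 0)) (begin
        map (mask (point 0)) (map e (applyUpTo suc q))  ≡⟨ map-∘ (applyUpTo suc q) ⟨
        map (mask (point 0) ∘ e) (applyUpTo suc q)      ≡⟨ map-applyUpTo suc _ q ⟩
        applyUpTo (mask (point 0) ∘ e ∘ suc) q          ≡⟨ applyUpTo-cong-< q entry≡ ⟩
        applyUpTo (λ j → just (elem (suc j) [])) q      ∎)

      witnessed : Holds r₀ (map e (upTo (suc q)))
      witnessed = here (here (cong (fact r₀) masked≡))

    e′⊭r₀ : ∀ (ts : Vec Tm (arity r₀)) → ¬ e′ ⊨ rel r₀ ts
    e′⊭r₀ ts s = s λ h → e′-holds-nothing r₀ _ (subst (Holds r₀) (evalTs-varsOf e′ ts) h)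

    HasFreeVars⇒Blind : ∀ k → k ≤ q → ∀ θ → HasFreeVars k θ → Blind θ
    HasFreeVars⇒Blind k k≤q θ (xs , fv) = Agree⇒Blind θ (UsesOnly-symbols θ) (λ x fr → ∈-toList⁺ (fv x fr))
      (inj₂ (short⇒¬Covers (toList xs) (subst (_≤ q) (sym (length-toList xs)) k≤q)))

    IsVarEq⇒Blind : ∀ θ → IsVarEq θ → Blind θ
    IsVarEq⇒Blind _ (i , j , refl) =
      (λ s k → s (k ∘ proj₁ (≡-agree i j))) , (λ s k → s (k ∘ proj₂ (≡-agree i j)))

    without-r₀⇒Blind : ∀ θ → r₀ ∉ symbols θ → Blind θ
    without-r₀⇒Blind θ r₀∉ =
      Agree⇒Blind θ (UsesOnly-symbols θ) (λ x fr → ∈-upTo⁺ (FreeBelow-varBound θ x fr)) (inj₁ r₀∉)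

    EquivBC⇒Blind : ∀ {ℓ} {B : Fm → Set ℓ} → (∀ χ → B χ → Blind χ) → ∀ χ → EquivBC T B χ → Blind χ
    EquivBC⇒Blind blindB χ (ψ , bψ , χ≡ψ)
      with TEquiv⇒M-equiv χ≡ψ e | TEquiv⇒M-equiv χ≡ψ e′ | BoolComb-agree e e′ blindB bψ
    ... | f , g | f′ , g′ | to , from = g′ ∘ to ∘ f , g ∘ from ∘ f′

    ¬EquivBC-r₀ : ∀ {ℓ} {B : Fm → Set ℓ} → (∀ χ → B χ → Blind χ) →
      ∀ (ts : Vec Tm (arity r₀)) → toList (varsOf ts) ≡ upTo (suc q) → ¬ EquivBC T B (rel r₀ ts)
    ¬EquivBC-r₀ blindB ts vars≡ r₀≡ψ = e′⊭r₀ ts (proj₁ (EquivBC⇒Blind blindB (rel r₀ ts) r₀≡ψ) (e⊨r₀ ts vars≡))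

  -- Arity bounds

  NFormula-base : ∀ k χ → HasFreeVars k χ → NFormula k T χ
  NFormula-base k χ h = χ , base h , λ _ _ _ → id , id

  Closed⇒HasFreeVars : ∀ k χ → Closed χ → HasFreeVars k χ
  Closed⇒HasFreeVars k χ closed = Vec.replicate k 0 , λ x fr → ⊥-elim (closed x fr)

  HasFreeVars-weaken : ∀ {k j} (χ : Fm) → k ≤ j → HasFreeVars k χ → HasFreeVars j χ
  HasFreeVars-weaken χ k≤j (xs , fv) = Vec.padRight k≤j 0 xs , λ x fr → ∈-padRight k≤j xs (fv x fr)
    where
    ∈-padRight : ∀ {k j x} (k≤j : k ≤ j) (xs : Vec ℕ k) → x V∈ xs → x V∈ Vec.padRight k≤j 0 xs
    ∈-padRight (s≤s _)   (_ ∷ _)  (here refl) = here refl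
    ∈-padRight (s≤s k≤j) (_ ∷ xs) (there p)   = there (∈-padRight k≤j xs p)

  rel-HasFreeVars : ∀ {k} r (xs : Vec ℕ (arity r)) → arity r ≤ k → HasFreeVars k (rel r (Vec.map var xs))
  rel-HasFreeVars r xs r≤k =
    HasFreeVars-weaken (rel r (Vec.map var xs)) r≤k (xs , λ x fr → ∈-toList⁻ (freeTs-var⇒∈ xs fr))

  ≈-HasFreeVars : ∀ i j → HasFreeVars {L = L} 2 (var i ≈' var j)
  ≈-HasFreeVars i j = i ∷ j ∷ [] , λ { _ (inj₁ refl) → here refl ; _ (inj₂ refl) → there (here refl) }

  varTuple : (ℕ → ℕ) → (k : ℕ) → Vec Tm k
  varTuple f zero    = []
  varTuple f (suc k) = var (f 0) ∷ varTuple (f ∘ suc) k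

  varsOf-varTuple : ∀ f k → toList (varsOf (varTuple f k)) ≡ applyUpTo f k
  varsOf-varTuple f zero    = refl
  varsOf-varTuple f (suc k) = cong (f 0 ∷_) (varsOf-varTuple (f ∘ suc) k)

  renTs-varTuple : ∀ ρ f k → renTs ρ (varTuple f k) ≡ varTuple (ρ ∘ f) k
  renTs-varTuple ρ f zero    = refl
  renTs-varTuple ρ f (suc k) = cong (var (ρ (f 0)) ∷_) (renTs-varTuple ρ (f ∘ suc) k)

  lookupOr0 : ∀ {k} → Vec ℕ k → ℕ → ℕ
  lookupOr0 []       _       = 0
  lookupOr0 (x ∷ xs) zero    = x
  lookupOr0 (x ∷ xs) (suc i) = lookupOr0 xs i

  varTuple-lookupOr0 : ∀ {k} (xs : Vec ℕ k) → varTuple (lookupOr0 xs) k ≡ Vec.map var xs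
  varTuple-lookupOr0 []       = refl
  varTuple-lookupOr0 (x ∷ xs) = cong (var x ∷_) (varTuple-lookupOr0 xs)

  varsOf-varTuple-id : ∀ {k q} → k ≡ suc q → toList (varsOf (varTuple id k)) ≡ upTo (suc q)
  varsOf-varTuple-id {k} refl = varsOf-varTuple id k

  S-atom : Fm
  S-atom = rel S (varTuple id n)

  ≈-atom : Fm
  ≈-atom = var 0 ≈' var 1

  almostNary : AlmostNary m T
  almostNary = ≈-atom ∷ S-atom ∷ [] , EquivBC-atomic classify
    where
    classify : ∀ V χ → IsAtom V χ ⊎ Closed χ →
      NFormula m T χ ⊎ Σ (ℕ → ℕ) λ ρ → Σ Fm λ θ → θ ∈ ≈-atom ∷ S-atom ∷ [] × χ ≡ renF ρ θ
    classify V χ (inj₂ closed) = inj₁ (NFormula-base m χ (Closed⇒HasFreeVars m χ closed))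
    classify V _ (inj₁ (eqAtom {i} {j} _ _)) = inj₂ (ρ , ≈-atom , here refl , refl)
      where
      ρ : ℕ → ℕ
      ρ zero    = i
      ρ (suc _) = j
    classify V _ (inj₁ (relAtom (R i) xs _)) = inj₁ (NFormula-base m (rel (R i) (Vec.map var xs)) (rel-HasFreeVars (R i) xs ≤-refl))
    classify V _ (inj₁ (relAtom S xs _))     = inj₂ (lookupOr0 xs , S-atom , there (here refl) ,
      cong (rel S) (sym (trans (renTs-varTuple (lookupOr0 xs) id n) (varTuple-lookupOr0 xs))))

  arity≤ : ∀ {k} → m ≤ k → n ≤ k → ∀ r → arity r ≤ k
  arity≤ m≤k n≤k (R _) = m≤k
  arity≤ m≤k n≤k S     = n≤k

  nary : ∀ k → 2 ≤ k → m ≤ k → n ≤ k → ∀ φ → NFormula k T φ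
  nary k 2≤k m≤k n≤k = EquivBC-atomic classify
    where
    classify : ∀ V χ → IsAtom V χ ⊎ Closed χ → HasFreeVars k χ
    classify V χ (inj₂ closed)                = Closed⇒HasFreeVars k χ closed
    classify V _ (inj₁ (eqAtom {i} {j} _ _))  = HasFreeVars-weaken (var i ≈' var j) 2≤k (≈-HasFreeVars i j)
    classify V _ (inj₁ (relAtom r xs _))      = rel-HasFreeVars r xs (arity≤ m≤k n≤k r)

  unary : m ≤ 1 → n ≤ 1 → Unary T
  unary m≤1 n≤1 = EquivBC-atomic classify
    where
    classify : ∀ V χ → IsAtom V χ ⊎ Closed χ → HasFreeVars 1 χ ⊎ IsVarEq χ
    classify V χ (inj₂ closed)                = inj₁ (Closed⇒HasFreeVars 1 χ closed)
    classify V _ (inj₁ (eqAtom {i} {j} _ _))  = inj₂ (i , j , refl)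
    classify V _ (inj₁ (relAtom r xs _))      = inj₁ (rel-HasFreeVars r xs (arity≤ m≤1 n≤1 r))

  symbols-renF : ∀ ρ θ → symbols (renF ρ θ) ≡ symbols θ
  symbols-renF ρ ⊥'         = refl
  symbols-renF ρ (rel _ _)  = refl
  symbols-renF ρ (_ ≈' _)   = refl
  symbols-renF ρ (φ ⇒ ψ)    = cong₂ _++_ (symbols-renF ρ φ) (symbols-renF ρ ψ)
  symbols-renF ρ (∀' φ)     = symbols-renF (ext {L = L} ρ) φ

  indexOf : Symbol → ℕ
  indexOf (R i) = i
  indexOf S     = 0

  freshIndex : List Fm → ℕ
  freshIndex φs = suc (max 0 (map indexOf (concatMap symbols φs)))

  freshIndex∉ : ∀ {φs θ} → θ ∈ φs → ∀ ρ → R (freshIndex φs) ∉ symbols (renF ρ θ)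
  freshIndex∉ {φs} {θ} θ∈ ρ p = <-irrefl refl (v≤max⁺ 0 _ (inj₂ (lose occurs ≤-refl)))
    where
    occurs : freshIndex φs ∈ map indexOf (concatMap symbols φs)
    occurs = ∈-map⁺ indexOf (∈-concatMap⁺ symbols (lose θ∈ (subst (R (freshIndex φs) ∈_) (symbols-renF ρ θ) p)))

  ¬AlmostNary : ∀ {q} → m ≡ suc q → ∀ k → k ≤ q → ¬ AlmostNary k T
  ¬AlmostNary {q} m≡1+q k k≤q (φs , expand) =
    ¬EquivBC-r₀ blind (varTuple id m) (varsOf-varTuple-id m≡1+q) (expand (rel (R N) (varTuple id m)))
    where
    N : ℕ
    N = freshIndex φs
    open Separation (R N) q

    blind : ∀ χ → NFormula k T χ ⊎ (Σ (ℕ → ℕ) λ ρ → Σ Fm λ θ → θ ∈ φs × χ ≡ renF ρ θ) → Blind χ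
    blind χ (inj₁ χ-nary)                 = EquivBC⇒Blind (HasFreeVars⇒Blind k k≤q) χ χ-nary
    blind _ (inj₂ (ρ , θ , θ∈ , refl))    = without-r₀⇒Blind (renF ρ θ) (freshIndex∉ θ∈ ρ)

  ¬IsNary : ∀ {k} → n ≡ suc (suc k) → ¬ IsNary (suc k) T
  ¬IsNary {zero} n≡2 isUnary = ¬EquivBC-r₀ blind (varTuple id n) (varsOf-varTuple-id n≡2) (isUnary S-atom)
    where
    open Separation S 1
    blind : ∀ χ → HasFreeVars 1 χ ⊎ IsVarEq χ → Blind χ
    blind χ = [ HasFreeVars⇒Blind 1 ≤-refl χ , IsVarEq⇒Blind χ ]
  ¬IsNary {suc k} n≡ isNary = ¬EquivBC-r₀ (HasFreeVars⇒Blind (suc (suc k)) ≤-refl) (varTuple id n)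
    (varsOf-varTuple-id n≡) (isNary S-atom)
    where open Separation S (suc (suc k))

aar-is-m : ∀ m n → 1 ≤ m → AarIs (Construction.T m n) m
aar-is-m (suc q) n 1≤m = 1≤m , almostNary , λ k _ k<1+q → ¬AlmostNary refl k (≤-pred k<1+q)
  where open Construction (suc q) n

ar-is-n : ∀ m n → 1 ≤ m → m ≤ n → ArIs (Construction.T m n) n
ar-is-n (suc zero)    (suc zero)    _ _       = Construction.unary 1 1 ≤-refl ≤-refl
ar-is-n (suc (suc _)) (suc zero)    _ (s≤s ())
ar-is-n m             (suc (suc k)) _ m≤n     = nary (suc (suc k)) (s≤s (s≤s z≤n)) m≤n ≤-refl , ¬IsNary refl
  where open Construction m (suc (suc k))

theorem2p1 : (m n : ℕ) → 1 ≤ m → m ≤ n →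
    Σ Language λ L → Σ (Theory L) λ T → HasModel T × AarIs T m × ArIs T n
theorem2p1 m n 1≤m m≤n = L , T , (M , M⊨T) , aar-is-m m n 1≤m , ar-is-n m n 1≤m m≤n
  where open Construction m n
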